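{- Let $n\geq 3$ and $3\leq k\leq n$. For $u=(u_1,\dots,u_n)\in\mathbb{R}^n$ define $v=(v_1,\dots,v_n)$ by $v_1=u_1$, $v_i=u_i-u_{i-1}$ for $2\leq i\leq k-1$, and $v_i=u_i-\sum_{j=i-k+1}^{i-1}u_j$ for $k\leq i\leq n$. For $1\leq\ell\leq k-1$ let $T_{k,\ell}$ be the $(k-1)$-bonacci sequence with initial terms $T_{k,\ell}(1)=\cdots=T_{k,\ell}(\ell-1)=0$ and $T_{k,\ell}(\ell)=\cdots=T_{k,\ell}(k-1)=1$. Then for $1\leq m\leq k-1$, \[ u_m=\sum_{j=1}^m v_j=\sum_{\ell=1}^m T_{k,\ell}(m)\,v_\ell , \] and for $k\leq m\leq n$, \[ u_m=\sum_{\ell=1}^{k-1}T_{k,\ell}(m)\,v_\ell+\sum_{i=1}^{m-k+1}T_{k,k-1}(m-i)\,v_{k-1+i}. \]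
   Context: A $(k-1)$-bonacci sequence $(a(i))_{i\geq 1}$ is a sequence determined by its initial terms $a(1),\dots,a(k-1)$ and the recurrence $a(i)=\sum_{j=1}^{k-1}a(i-j)$ for all $i\geq k$. -}

module Defs where

open import Level using (Level)
open import Data.Nat using (ℕ; zero; suc; _+_; _∸_; _≤_; _<_; _<?_)
open import Data.Product using (_×_)
open import Relation.Nullary using (yes; no)
open import Relation.Binary.PropositionalEquality using (_≡_)
open import Algebra.Bundles using (CommutativeRing)

sumℕ : ℕ → ℕ → (ℕ → ℕ) → ℕ
sumℕ a zero    f = 0
sumℕ a (suc c) f = f a + sumℕ (suc a) c f

IsBonacci : ℕ → (ℕ → ℕ) → Set
IsBonacci k a = ∀ i → k ≤ i → a i ≡ sumℕ 1 (k ∸ 1) (λ j → a (i ∸ j))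

IsTFamily : ℕ → (ℕ → ℕ → ℕ) → Set
IsTFamily k T = ∀ ℓ → 1 ≤ ℓ → ℓ ≤ k ∸ 1 →
  (∀ i → 1 ≤ i → i < ℓ → T ℓ i ≡ 0) ×
  (∀ i → ℓ ≤ i → i ≤ k ∸ 1 → T ℓ i ≡ 1) ×
  IsBonacci k (T ℓ)

module WithRing {c ℓ : Level} (R : CommutativeRing c ℓ) where
  open CommutativeRing R renaming (_+_ to _+R_; _-_ to _-R_)

  ∑ : ℕ → ℕ → (ℕ → Carrier) → Carrier
  ∑ a zero    f = 0#
  ∑ a (suc c) f = f a +R ∑ (suc a) c f

  times : ℕ → Carrier → Carrier
  times zero    x = 0#
  times (suc n) x = x +R times n x

  -- the vector v from u (both indexed from 1; index 0 unused)
  vOf : ℕ → (ℕ → Carrier) → ℕ → Carrier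
  vOf k u zero = 0#
  vOf k u (suc zero) = u 1
  vOf k u (suc (suc j)) with suc (suc j) <? k
  ... | yes _ = u (suc (suc j)) -R u (suc j)
  ... | no  _ = u (suc (suc j)) -R ∑ (suc (suc j) + 1 ∸ k) (k ∸ 1) u

{-# OPTIONS --safe #-}
module Submission where

-- Solving v m = u m - (u (m-1) + … + u (m - w m)) for u, where the window length w m is 0 for
-- m = 1, 1 for 2 ≤ m ≤ k-1 and k-1 for m ≥ k, exhibits u as the superposition Σ_l v_l e_l of the
-- impulse responses e_l, the solutions for v = δ_l.  For l ≤ k-1 the response vanishes before
-- l, equals 1 from l to k-1 and then follows the (k-1)-bonacci rule: it is T_{k,l}.  For
-- l = k-1+i it is 0,…,0,1 (the 1 at l) continued by the bonacci rule, i.e. T_{k,k-1} delayed by i.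

open import Defs
open import Level using (Level)
open import Data.Nat using (ℕ; zero; suc; _+_; _∸_; _≤_; _<_; z≤n; s≤s; s≤s⁻¹; _≟_; _≤?_; _<?_)
open import Data.Nat.Properties
open import Data.Nat.Induction using (<-rec)
open import Data.Product using (_×_; _,_; proj₁; proj₂)
open import Data.Sum using (inj₁; inj₂)
open import Data.Empty using (⊥-elim)
open import Relation.Nullary using (yes; no)
open import Relation.Binary using (tri<; tri≈; tri>)
open import Relation.Binary.PropositionalEquality as ≡ using (_≡_; _≢_; cong; cong₂; subst)
open import Algebra.Bundles using (CommutativeRing)
import Algebra.Properties.CommutativeSemigroup as CommutativeSemigroupProperties
import Algebra.Properties.Group as GroupProperties
import Algebra.Properties.Monoid.Mult as MonoidMult
import Relation.Binary.Reasoning.Setoid as SetoidReasoning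

∸-∸-comm : ∀ m n o → m ∸ n ∸ o ≡ m ∸ o ∸ n
∸-∸-comm m n o = ≡.trans (∸-+-assoc m n o)
  (≡.trans (cong (m ∸_) (+-comm n o)) (≡.sym (∸-+-assoc m o n)))

δ : ℕ → ℕ → ℕ
δ l m with l ≟ m
... | yes _ = 1
... | no  _ = 0

δ-refl : ∀ l → δ l l ≡ 1
δ-refl l with l ≟ l
... | yes _  = ≡.refl
... | no l≢l = ⊥-elim (l≢l ≡.refl)

δ-≢ : ∀ {l m} → l ≢ m → δ l m ≡ 0
δ-≢ {l} {m} l≢m with l ≟ m
... | yes l≡m = ⊥-elim (l≢m l≡m)
... | no  _   = ≡.refl

δ-cong-⇔ : ∀ {l m l′ m′} → (l ≡ m → l′ ≡ m′) → (l′ ≡ m′ → l ≡ m) → δ l m ≡ δ l′ m′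
δ-cong-⇔ {l} {m} {l′} {m′} to from with l ≟ m | l′ ≟ m′
... | yes _   | yes _     = ≡.refl
... | no  _   | no  _     = ≡.refl
... | yes l≡m | no l′≢m′  = ⊥-elim (l′≢m′ (to l≡m))
... | no  l≢m | yes l′≡m′ = ⊥-elim (l≢m (from l′≡m′))

sumℕ-cong : ∀ a c {f g : ℕ → ℕ} → (∀ i → a ≤ i → i < a + c → f i ≡ g i) →
            sumℕ a c f ≡ sumℕ a c g
sumℕ-cong a zero    f≗g = ≡.refl
sumℕ-cong a (suc c) f≗g = cong₂ _+_ (f≗g a ≤-refl (m<m+n a (s≤s z≤n)))
  (sumℕ-cong (suc a) c λ i a<i i<1+a+c →
    f≗g i (<⇒≤ a<i) (subst (i <_) (≡.sym (+-suc a c)) i<1+a+c))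

sumℕ-zero : ∀ a c {f : ℕ → ℕ} → (∀ i → a ≤ i → i < a + c → f i ≡ 0) → sumℕ a c f ≡ 0
sumℕ-zero a c f≗0 = ≡.trans (sumℕ-cong a c f≗0) (zeros a c)
  where
  zeros : ∀ a c → sumℕ a c (λ _ → 0) ≡ 0
  zeros a zero    = ≡.refl
  zeros a (suc c) = zeros (suc a) c

module Sums {c ℓ : Level} (R : CommutativeRing c ℓ) where
  open CommutativeRing R using (Carrier; _≈_; 0#; setoid) renaming (_+_ to _+R_)
  private module R = CommutativeRing R
  open WithRing R
  open MonoidMult R.+-monoid using (×-homo-+) renaming (_×_ to _·_)
  open CommutativeSemigroupProperties R.+-commutativeSemigroup using (interchange)
  open SetoidReasoning setoid

  times≡· : ∀ n x → times n x ≡ n · x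
  times≡· zero    x = ≡.refl
  times≡· (suc n) x = cong (x +R_) (times≡· n x)

  times-+ : ∀ m n x → times (m + n) x ≈ times m x +R times n x
  times-+ m n x = begin
    times (m + n) x         ≡⟨ times≡· (m + n) x ⟩
    (m + n) · x             ≈⟨ ×-homo-+ x m n ⟩
    m · x +R n · x          ≡⟨ cong₂ _+R_ (times≡· m x) (times≡· n x) ⟨
    times m x +R times n x  ∎

  times-congˡ : ∀ {p q x} → p ≡ q → times p x ≈ times q x
  times-congˡ ≡.refl = R.refl

  ∑-cong : ∀ a c {f g : ℕ → Carrier} → (∀ i → a ≤ i → i < a + c → f i ≈ g i) →
           ∑ a c f ≈ ∑ a c g
  ∑-cong a zero    f≈g = R.refl
  ∑-cong a (suc c) f≈g = R.+-cong (f≈g a ≤-refl (m<m+n a (s≤s z≤n)))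
    (∑-cong (suc a) c λ i a<i i<1+a+c →
      f≈g i (<⇒≤ a<i) (subst (i <_) (≡.sym (+-suc a c)) i<1+a+c))

  ∑-zero : ∀ a c {f : ℕ → Carrier} → (∀ i → a ≤ i → i < a + c → f i ≈ 0#) → ∑ a c f ≈ 0#
  ∑-zero a c f≈0 = R.trans (∑-cong a c f≈0) (zeros a c)
    where
    zeros : ∀ a c → ∑ a c (λ _ → 0#) ≈ 0#
    zeros a zero    = R.refl
    zeros a (suc c) = R.trans (R.+-identityˡ _) (zeros (suc a) c)

  ∑-distrib-+ : ∀ a c (f g : ℕ → Carrier) → ∑ a c (λ i → f i +R g i) ≈ ∑ a c f +R ∑ a c g
  ∑-distrib-+ a zero    f g = R.sym (R.+-identityˡ 0#)
  ∑-distrib-+ a (suc c) f g =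
    R.trans (R.+-congˡ (∑-distrib-+ (suc a) c f g)) (interchange _ _ _ _)

  ∑-comm : ∀ a c b d (f : ℕ → ℕ → Carrier) →
           ∑ a c (λ i → ∑ b d (f i)) ≈ ∑ b d (λ j → ∑ a c (λ i → f i j))
  ∑-comm a zero    b d f = R.sym (∑-zero b d λ _ _ _ → R.refl)
  ∑-comm a (suc c) b d f = R.trans (R.+-congˡ (∑-comm (suc a) c b d f))
    (R.sym (∑-distrib-+ b d (f a) (λ j → ∑ (suc a) c (λ i → f i j))))

  times-sumℕ : ∀ a c f x → times (sumℕ a c f) x ≈ ∑ a c (λ j → times (f j) x)
  times-sumℕ a zero    f x = R.refl
  times-sumℕ a (suc c) f x = R.trans (times-+ (f a) _ x) (R.+-congˡ (times-sumℕ (suc a) c f x))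

  ∑-δ : ∀ a c {m} (w : ℕ → Carrier) → a ≤ m → m < a + c →
        ∑ a c (λ l → times (δ l m) (w l)) ≈ w m
  ∑-δ a zero    w a≤m m<a+0 = ⊥-elim (<⇒≱ m<a+0 (subst (_≤ _) (≡.sym (+-identityʳ a)) a≤m))
  ∑-δ a (suc c) {m} w a≤m m<a+c with m≤n⇒m<n∨m≡n a≤m
  ... | inj₂ ≡.refl = begin
    times (δ a a) (w a) +R ∑ (suc a) c (λ l → times (δ l a) (w l))
      ≈⟨ R.+-cong (times-congˡ (δ-refl a))
                  (∑-zero (suc a) c λ l a<l _ → times-congˡ (δ-≢ (>⇒≢ a<l))) ⟩
    times 1 (w a) +R 0#   ≈⟨ R.+-identityʳ _ ⟩
    times 1 (w a)         ≈⟨ R.+-identityʳ _ ⟩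
    w a                   ∎
  ... | inj₁ a<m = R.trans
    (R.+-cong (times-congˡ (δ-≢ (<⇒≢ a<m)))
              (∑-δ (suc a) c w a<m (subst (m <_) (+-suc a c) m<a+c)))
    (R.+-identityˡ _)

  ∑-snoc : ∀ a c f → ∑ a (suc c) f ≈ ∑ a c f +R f (a + c)
  ∑-snoc a zero    f = R.trans (R.+-identityʳ (f a))
    (R.trans (R.reflexive (cong f (≡.sym (+-identityʳ a)))) (R.sym (R.+-identityˡ _)))
  ∑-snoc a (suc c) f = begin
    f a +R ∑ (suc a) (suc c) f               ≈⟨ R.+-congˡ (∑-snoc (suc a) c f) ⟩
    f a +R (∑ (suc a) c f +R f (suc a + c))  ≈⟨ R.+-assoc _ _ _ ⟨
    f a +R ∑ (suc a) c f +R f (suc a + c)    ≡⟨ cong (λ i → f a +R ∑ (suc a) c f +R f i) (+-suc a c) ⟨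
    f a +R ∑ (suc a) c f +R f (a + suc c)    ∎

  ∑-reverse : ∀ d c f → ∑ d c f ≈ ∑ 1 c (λ j → f (d + c ∸ j))
  ∑-reverse d zero    f = R.refl
  ∑-reverse d (suc c) f = begin
    f d +R ∑ (suc d) c f                              ≈⟨ R.+-congˡ (∑-reverse (suc d) c f) ⟩
    f d +R ∑ 1 c (λ j → f (suc d + c ∸ j))            ≈⟨ R.+-comm _ _ ⟩
    ∑ 1 c (λ j → f (suc d + c ∸ j)) +R f d            ≈⟨ R.+-cong
        (∑-cong 1 c λ j _ _ → R.reflexive (cong (λ n → f (n ∸ j)) (+-suc d c)))
        (R.reflexive (cong f (m+n∸n≡m d (suc c)))) ⟨
    ∑ 1 c (λ j → f (d + suc c ∸ j)) +R f (d + suc c ∸ suc c)  ≈⟨ ∑-snoc 1 c _ ⟨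
    ∑ 1 (suc c) (λ j → f (d + suc c ∸ j))             ∎

  ∑-++ : ∀ a b c f → ∑ a (b + c) f ≈ ∑ a b f +R ∑ (b + a) c f
  ∑-++ a zero    c f = R.sym (R.+-identityˡ _)
  ∑-++ a (suc b) c f = R.trans (R.+-congˡ (∑-++ (suc a) b c f))
    (R.trans (R.sym (R.+-assoc _ _ _)) (R.+-congˡ (R.reflexive (cong (λ i → ∑ i c f) (+-suc b a)))))

  ∑-shift : ∀ s a c f → ∑ (s + a) c f ≡ ∑ a c (λ i → f (s + i))
  ∑-shift s a zero    f = ≡.refl
  ∑-shift s a (suc c) f = cong (f (s + a) +R_)
    (≡.trans (cong (λ i → ∑ i c f) (≡.sym (+-suc s a))) (∑-shift s (suc a) c f))

module Superposition {c ℓ : Level} (R : CommutativeRing c ℓ)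
                     (w : ℕ → ℕ) (w<id : ∀ m → 1 ≤ m → w m < m) where
  open CommutativeRing R using (Carrier; _≈_; setoid) renaming (_+_ to _+R_)
  private module R = CommutativeRing R
  open WithRing R
  open Sums R
  open SetoidReasoning setoid

  superposition : (e : ℕ → ℕ → ℕ) →
    (∀ l m → 1 ≤ l → 1 ≤ m → e l m ≡ δ l m + sumℕ 1 (w m) (λ j → e l (m ∸ j))) →
    (u v : ℕ → Carrier) →
    (∀ m → 1 ≤ m → u m ≈ v m +R ∑ 1 (w m) (λ j → u (m ∸ j))) →
    ∀ N m → 1 ≤ m → m ≤ N → u m ≈ ∑ 1 N (λ l → times (e l m) (v l))
  superposition e e-impulse u v u-recursion N = <-rec P step
    where
    P : ℕ → Set ℓ
    P m = 1 ≤ m → m ≤ N → u m ≈ ∑ 1 N (λ l → times (e l m) (v l))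

    step : ∀ m → (∀ {j} → j < m → P j) → P m
    step m IH 1≤m m≤N = begin
      u m
        ≈⟨ u-recursion m 1≤m ⟩
      v m +R ∑ 1 (w m) (λ j → u (m ∸ j))
        ≈⟨ R.+-congˡ (∑-cong 1 (w m) earlier) ⟩
      v m +R ∑ 1 (w m) (λ j → ∑ 1 N (λ l → times (e l (m ∸ j)) (v l)))
        ≈⟨ R.+-congˡ (∑-comm 1 (w m) 1 N (λ j l → times (e l (m ∸ j)) (v l))) ⟩
      v m +R ∑ 1 N (λ l → ∑ 1 (w m) (λ j → times (e l (m ∸ j)) (v l)))
        ≈⟨ R.+-cong (∑-δ 1 N v 1≤m (s≤s m≤N))
                    (∑-cong 1 N λ l _ _ → times-sumℕ 1 (w m) (λ j → e l (m ∸ j)) (v l)) ⟨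
      ∑ 1 N (λ l → times (δ l m) (v l)) +R ∑ 1 N (λ l → times (window l) (v l))
        ≈⟨ ∑-distrib-+ 1 N _ _ ⟨
      ∑ 1 N (λ l → times (δ l m) (v l) +R times (window l) (v l))
        ≈⟨ ∑-cong 1 N (λ l _ _ → times-+ (δ l m) (window l) (v l)) ⟨
      ∑ 1 N (λ l → times (δ l m + window l) (v l))
        ≈⟨ ∑-cong 1 N (λ l 1≤l _ → times-congˡ (e-impulse l m 1≤l 1≤m)) ⟨
      ∑ 1 N (λ l → times (e l m) (v l))
        ∎
      where
      window : ℕ → ℕ
      window l = sumℕ 1 (w m) (λ j → e l (m ∸ j))

      earlier : ∀ j → 1 ≤ j → j < 1 + w m → u (m ∸ j) ≈ ∑ 1 N (λ l → times (e l (m ∸ j)) (v l))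
      earlier j 1≤j j<1+w = IH (∸-monoʳ-< 1≤j (<⇒≤ j<m)) (m<n⇒0<n∸m j<m) (≤-trans (m∸n≤m m j) m≤N)
        where
        j<m : j < m
        j<m = ≤-<-trans (s≤s⁻¹ j<1+w) (w<id m 1≤m)

lookback : ℕ → ℕ → ℕ
lookback K zero          = 0
lookback K (suc zero)    = 0
lookback K (suc (suc j)) with suc (suc j) <? suc K
... | yes _ = 1
... | no  _ = K

lookback<id : ∀ K m → 1 ≤ m → lookback K m < m
lookback<id K (suc zero)    _ = s≤s z≤n
lookback<id K (suc (suc j)) _ with suc (suc j) <? suc K
... | yes _   = s≤s (s≤s z≤n)
... | no  m≮k = ≮⇒≥ m≮k

lookback-recursion : ∀ K (e d : ℕ → ℕ) →
  e 1 ≡ d 1 →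
  (∀ m → 2 ≤ m → m ≤ K → e m ≡ d m + e (m ∸ 1)) →
  (∀ m → K < m → e m ≡ d m + sumℕ 1 K (λ j → e (m ∸ j))) →
  ∀ m → 1 ≤ m → e m ≡ d m + sumℕ 1 (lookback K m) (λ j → e (m ∸ j))
lookback-recursion K e d first initial tail (suc zero) _ = ≡.trans first (≡.sym (+-identityʳ (d 1)))
lookback-recursion K e d first initial tail (suc (suc j)) _ with suc (suc j) <? suc K
... | yes m<k = ≡.trans (initial _ (s≤s (s≤s z≤n)) (s≤s⁻¹ m<k))
                        (cong (d (suc (suc j)) +_) (≡.sym (+-identityʳ (e (suc j)))))
... | no  m≮k = tail _ (≮⇒≥ m≮k)

module Responses (K : ℕ) (1≤K : 1 ≤ K) (T : ℕ → ℕ → ℕ) (T-family : IsTFamily (suc K) T) where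

  T-below : ∀ {l i} → 1 ≤ l → l ≤ K → 1 ≤ i → i < l → T l i ≡ 0
  T-below 1≤l l≤K = proj₁ (T-family _ 1≤l l≤K) _

  T-above : ∀ {l i} → 1 ≤ l → l ≤ K → l ≤ i → i ≤ K → T l i ≡ 1
  T-above 1≤l l≤K = proj₁ (proj₂ (T-family _ 1≤l l≤K)) _

  T-bonacci : ∀ {l} → 1 ≤ l → l ≤ K → ∀ i → K < i → T l i ≡ sumℕ 1 K (λ j → T l (i ∸ j))
  T-bonacci 1≤l l≤K = proj₂ (proj₂ (T-family _ 1≤l l≤K))

  T-impulse : ∀ {l} → 1 ≤ l → l ≤ K →
    ∀ m → 1 ≤ m → T l m ≡ δ l m + sumℕ 1 (lookback K m) (λ j → T l (m ∸ j))
  T-impulse {l} 1≤l l≤K = lookback-recursion K (T l) (δ l) first initial tail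
    where
    first : T l 1 ≡ δ l 1
    first with m≤n⇒m<n∨m≡n 1≤l
    ... | inj₁ 1<l    = ≡.trans (T-below 1≤l l≤K ≤-refl 1<l) (≡.sym (δ-≢ (>⇒≢ 1<l)))
    ... | inj₂ ≡.refl = T-above ≤-refl l≤K ≤-refl l≤K

    initial : ∀ m → 2 ≤ m → m ≤ K → T l m ≡ δ l m + T l (m ∸ 1)
    initial (suc m) (s≤s 1≤m) m<K with <-cmp l (suc m)
    ... | tri< l<1+m _ _ = ≡.trans (T-above 1≤l l≤K (<⇒≤ l<1+m) m<K)
      (≡.sym (cong₂ _+_ (δ-≢ (<⇒≢ l<1+m)) (T-above 1≤l l≤K (s≤s⁻¹ l<1+m) (<⇒≤ m<K))))
    ... | tri≈ _ ≡.refl _ = ≡.trans (T-above 1≤l l≤K ≤-refl m<K)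
      (≡.sym (cong₂ _+_ (δ-refl l) (T-below 1≤l l≤K 1≤m ≤-refl)))
    ... | tri> _ _ 1+m<l = ≡.trans (T-below 1≤l l≤K (s≤s z≤n) 1+m<l)
      (≡.sym (cong₂ _+_ (δ-≢ (>⇒≢ 1+m<l)) (T-below 1≤l l≤K 1≤m (<⇒≤ 1+m<l))))

    tail : ∀ m → K < m → T l m ≡ δ l m + sumℕ 1 K (λ j → T l (m ∸ j))
    tail m K<m = ≡.trans (T-bonacci 1≤l l≤K m K<m)
      (cong (_+ sumℕ 1 K (λ j → T l (m ∸ j))) (≡.sym (δ-≢ (<⇒≢ (≤-<-trans l≤K K<m)))))

  -- T K with its value at 0, left unconstrained by IsTFamily, set to 0: the delayed copies
  -- pulse (m ∸ i) must vanish for m ≤ i.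
  pulse : ℕ → ℕ
  pulse zero    = 0
  pulse (suc x) = T K (suc x)

  pulse-pos : ∀ {x} → 1 ≤ x → pulse x ≡ T K x
  pulse-pos {suc x} _ = ≡.refl

  pulse-below : ∀ {x} → x < K → pulse x ≡ 0
  pulse-below {zero}  _   = ≡.refl
  pulse-below {suc x} x<K = T-below 1≤K ≤-refl (s≤s z≤n) x<K

  pulse-recursion : ∀ x → pulse x ≡ δ x K + sumℕ 1 K (λ j → pulse (x ∸ j))
  pulse-recursion x with <-cmp x K
  ... | tri< x<K _ _ = ≡.trans (pulse-below x<K) (≡.sym (cong₂ _+_ (δ-≢ (<⇒≢ x<K))
      (sumℕ-zero 1 K λ j _ _ → pulse-below (≤-<-trans (m∸n≤m x j) x<K))))
  ... | tri≈ _ ≡.refl _ = ≡.trans (pulse-pos 1≤K) (≡.trans (T-above 1≤K ≤-refl ≤-refl ≤-refl)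
      (≡.sym (cong₂ _+_ (δ-refl K)
        (sumℕ-zero 1 K λ j 1≤j j<1+K → pulse-below (∸-monoʳ-< 1≤j (s≤s⁻¹ j<1+K))))))
  ... | tri> _ _ K<x = ≡.trans (pulse-pos (≤-<-trans z≤n K<x)) (≡.trans (T-bonacci 1≤K ≤-refl x K<x)
      (≡.trans (sumℕ-cong 1 K λ j _ j<1+K →
                  ≡.sym (pulse-pos (m<n⇒0<n∸m (≤-<-trans (s≤s⁻¹ j<1+K) K<x))))
               (cong (_+ sumℕ 1 K (λ j → pulse (x ∸ j))) (≡.sym (δ-≢ (>⇒≢ K<x))))))

  delayed-pulse-recursion : ∀ i m →
    pulse (m ∸ i) ≡ δ (K + i) m + sumℕ 1 K (λ j → pulse (m ∸ j ∸ i))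
  delayed-pulse-recursion i m = ≡.trans (pulse-recursion (m ∸ i))
    (cong₂ _+_ (δ-cong-⇔ to from) (sumℕ-cong 1 K λ j _ _ → cong pulse (∸-∸-comm m i j)))
    where
    to : m ∸ i ≡ K → K + i ≡ m
    to m∸i≡K = ≡.trans (cong (_+ i) (≡.sym m∸i≡K)) (m∸n+n≡m (<⇒≤ i<m))
      where
      i<m : i < m
      i<m = m∸n≢0⇒n<m λ m∸i≡0 → <⇒≢ 1≤K (≡.trans (≡.sym m∸i≡0) m∸i≡K)
    from : K + i ≡ m → m ∸ i ≡ K
    from ≡.refl = m+n∸n≡m K i

  delayed-pulse-impulse : ∀ {i} → 1 ≤ i →
    ∀ m → 1 ≤ m → pulse (m ∸ i) ≡ δ (K + i) m + sumℕ 1 (lookback K m) (λ j → pulse (m ∸ j ∸ i))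
  delayed-pulse-impulse {i} 1≤i =
    lookback-recursion K (λ m → pulse (m ∸ i)) (δ (K + i))
      (≡.trans (silent 1≤K) (≡.sym (δ-silent 1≤K)))
      (λ m _ m≤K → ≡.trans (silent m≤K)
        (≡.sym (cong₂ _+_ (δ-silent m≤K) (silent (≤-trans (m∸n≤m m 1) m≤K)))))
      (λ m _ → delayed-pulse-recursion i m)
    where
    silent : ∀ {m} → m ≤ K → pulse (m ∸ i) ≡ 0
    silent {zero}  _     = pulse-below (subst (_< K) (≡.sym (0∸n≡0 i)) 1≤K)
    silent {suc m} 1+m≤K = pulse-below (≤-<-trans (∸-monoʳ-≤ (suc m) 1≤i) 1+m≤K)
    δ-silent : ∀ {m} → m ≤ K → δ (K + i) m ≡ 0
    δ-silent m≤K = δ-≢ (>⇒≢ (≤-<-trans m≤K (m<m+n K 1≤i)))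

  response : ℕ → ℕ → ℕ
  response l with l ≤? K
  ... | yes _ = T l
  ... | no  _ = λ m → pulse (m ∸ (l ∸ K))

  response-≤ : ∀ {l} m → l ≤ K → response l m ≡ T l m
  response-≤ {l} m l≤K with l ≤? K
  ... | yes _   = ≡.refl
  ... | no  l≰K = ⊥-elim (l≰K l≤K)

  response-delayed : ∀ {i} m → 1 ≤ i → response (K + i) m ≡ pulse (m ∸ i)
  response-delayed {i} m 1≤i with K + i ≤? K
  ... | yes K+i≤K = ⊥-elim (<⇒≱ (m<m+n K 1≤i) K+i≤K)
  ... | no  _     = cong (λ d → pulse (m ∸ d)) (m+n∸m≡n K i)

  response-impulse : ∀ l m → 1 ≤ l → 1 ≤ m →
    response l m ≡ δ l m + sumℕ 1 (lookback K m) (λ j → response l (m ∸ j))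
  response-impulse l m 1≤l 1≤m with l ≤? K
  ... | yes l≤K = T-impulse 1≤l l≤K m 1≤m
  ... | no  l≰K =
    subst (λ l′ → pulse (m ∸ i) ≡ δ l′ m + sumℕ 1 (lookback K m) (λ j → pulse (m ∸ j ∸ i)))
          (m+[n∸m]≡n (<⇒≤ K<l)) (delayed-pulse-impulse (m<n⇒0<n∸m K<l) m 1≤m)
    where
    K<l : K < l
    K<l = ≰⇒> l≰K
    i : ℕ
    i = l ∸ K

module Expansion {c ℓ : Level} (R : CommutativeRing c ℓ)
                 (K : ℕ) (1≤K : 1 ≤ K) (T : ℕ → ℕ → ℕ) (T-family : IsTFamily (suc K) T)
                 (u : ℕ → CommutativeRing.Carrier R) where
  open CommutativeRing R using (Carrier; _≈_; setoid; +-group) renaming (_+_ to _+R_)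
  private module R = CommutativeRing R
  open WithRing R
  open Sums R
  open Superposition R (lookback K) (lookback<id K)
  open Responses K 1≤K T T-family
  open GroupProperties +-group using (//-rightDividesˡ)
  open SetoidReasoning setoid

  v : ℕ → Carrier
  v = vOf (suc K) u

  u-lookback : ∀ m → 1 ≤ m → u m ≈ v m +R ∑ 1 (lookback K m) (λ j → u (m ∸ j))
  u-lookback (suc zero)    _ = R.sym (R.+-identityʳ (u 1))
  u-lookback (suc (suc j)) _ with suc (suc j) <? suc K
  ... | yes _   = R.trans (R.sym (//-rightDividesˡ (u (suc j)) (u (suc (suc j)))))
                          (R.+-congˡ (R.sym (R.+-identityʳ (u (suc j)))))
  ... | no  m≮k = R.trans (R.sym (//-rightDividesˡ window (u m))) (R.+-congˡ reversed)
    where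
    m : ℕ
    m = suc (suc j)
    window : Carrier
    window = ∑ (m + 1 ∸ suc K) K u
    reversed : window ≈ ∑ 1 K (λ i → u (m ∸ i))
    reversed = R.trans (∑-reverse (m + 1 ∸ suc K) K u)
      (∑-cong 1 K λ i _ _ → R.reflexive (cong (λ n → u (n ∸ i))
        (≡.trans (cong (λ n → n ∸ suc K + K) (+-comm m 1)) (m∸n+n≡m (<⇒≤ (≮⇒≥ m≮k))))))

  u-expansion : ∀ m → 1 ≤ m → u m ≈ ∑ 1 m (λ l → times (response l m) (v l))
  u-expansion m 1≤m = superposition response response-impulse u v u-lookback m m 1≤m ≤-refl

  u-initial : ∀ m → 1 ≤ m → m ≤ K → u m ≈ ∑ 1 m (λ l → times (T l m) (v l))
  u-initial m 1≤m m≤K = R.trans (u-expansion m 1≤m) (∑-cong 1 m λ l _ l<1+m →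
    times-congˡ (response-≤ m (≤-trans (s≤s⁻¹ l<1+m) m≤K)))

  u-initial-partialSum : ∀ m → 1 ≤ m → m ≤ K → u m ≈ ∑ 1 m v
  u-initial-partialSum m 1≤m m≤K = R.trans (u-initial m 1≤m m≤K) (∑-cong 1 m λ l 1≤l l<1+m →
    R.trans (times-congˡ (T-above 1≤l (≤-trans (s≤s⁻¹ l<1+m) m≤K) (s≤s⁻¹ l<1+m) m≤K))
            (R.+-identityʳ (v l)))

  u-tail : ∀ m → K < m →
    u m ≈ ∑ 1 K (λ l → times (T l m) (v l))
          +R ∑ 1 (m + 1 ∸ suc K) (λ i → times (T K (m ∸ i)) (v (K + i)))
  u-tail m K<m = begin
    u m
      ≈⟨ u-expansion m (≤-<-trans z≤n K<m) ⟩
    ∑ 1 m F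
      ≡⟨ cong (λ n → ∑ 1 n F) (m+[n∸m]≡n K≤m) ⟨
    ∑ 1 (K + (m ∸ K)) F
      ≈⟨ ∑-++ 1 K (m ∸ K) F ⟩
    ∑ 1 K F +R ∑ (K + 1) (m ∸ K) F
      ≡⟨ cong (∑ 1 K F +R_) (∑-shift K 1 (m ∸ K) F) ⟩
    ∑ 1 K F +R ∑ 1 (m ∸ K) (λ i → F (K + i))
      ≈⟨ R.+-cong (∑-cong 1 K undelayed) (∑-cong 1 (m ∸ K) delayed) ⟩
    ∑ 1 K G +R ∑ 1 (m ∸ K) H
      ≡⟨ cong (λ n → ∑ 1 K G +R ∑ 1 n H) (cong (_∸ suc K) (+-comm m 1)) ⟨
    ∑ 1 K G +R ∑ 1 (m + 1 ∸ suc K) H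
      ∎
    where
    K≤m : K ≤ m
    K≤m = <⇒≤ K<m
    F G H : ℕ → Carrier
    F l = times (response l m) (v l)
    G l = times (T l m) (v l)
    H i = times (T K (m ∸ i)) (v (K + i))
    undelayed : ∀ l → 1 ≤ l → l < 1 + K → F l ≈ G l
    undelayed l _ l<1+K = times-congˡ (response-≤ m (s≤s⁻¹ l<1+K))
    delayed : ∀ i → 1 ≤ i → i < 1 + (m ∸ K) → F (K + i) ≈ H i
    delayed i 1≤i i<1+m∸K =
      times-congˡ (≡.trans (response-delayed m 1≤i) (pulse-pos (m<n⇒0<n∸m i<m)))
      where
      i<m : i < m
      i<m = ≤-<-trans (s≤s⁻¹ i<1+m∸K) (∸-monoʳ-< 1≤K K≤m)

mainTheorem2 : {c ℓ : Level} (R : CommutativeRing c ℓ) →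
    let open CommutativeRing R renaming (_+_ to _+R_) in let open WithRing R in
    (n k : ℕ) → 3 ≤ n → 3 ≤ k → k ≤ n →
    (T : ℕ → ℕ → ℕ) → IsTFamily k T →
    (u : ℕ → Carrier) →
    (∀ m → 1 ≤ m → m ≤ k ∸ 1 →
      (u m ≈ ∑ 1 m (vOf k u)) ×
      (u m ≈ ∑ 1 m (λ l → times (T l m) (vOf k u l)))) ×
    (∀ m → k ≤ m → m ≤ n →
      u m ≈ ∑ 1 (k ∸ 1) (λ l → times (T l m) (vOf k u l))
            +R ∑ 1 (m + 1 ∸ k) (λ i → times (T (k ∸ 1) (m ∸ i)) (vOf k u (k ∸ 1 + i))))
mainTheorem2 R _ (suc K) _ 3≤k _ T T-family u =
  (λ m 1≤m m≤K → u-initial-partialSum m 1≤m m≤K , u-initial m 1≤m m≤K) ,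
  (λ m K<m _ → u-tail m K<m)
  where
  open Expansion R K (≤-trans (s≤s z≤n) (s≤s⁻¹ 3≤k)) T T-family u
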